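{- Let $G$ be a $3$-connected graph and $C\subseteq G$ a non-interleaved cycle. Then $C$ is an induced cycle.
   Context: A cycle $C\subseteq G$ is interleaved if there are vertices $v_1,v_2,v_3,v_4\in V(C)$ occurring along $C$ in this order and vertex-disjoint paths in $G-E(C)$ connecting $v_1$ with $v_3$ and $v_2$ with $v_4$, respectively; otherwise it is non-interleaved. An induced cycle is a cycle that is an induced subgraph (i.e., chordless). Graphs are simple. -}

module Defs where

open import Data.Nat as ℕ using (ℕ; suc; _<_)
open import Data.Fin using (Fin; zero; suc; toℕ; lower₁) renaming (_<_ to _<ᶠ_)
open import Data.List using (List; []; _∷_; length)
open import Data.List.Membership.Propositional using (_∈_; _∉_)
open import Data.List.Relation.Unary.All using (All)
open import Data.List.Relation.Unary.Unique.Propositional using (Unique)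
open import Data.Product using (Σ; ∃; _×_; _,_)
open import Data.Sum using (_⊎_)
open import Data.Empty using (⊥)
open import Relation.Nullary using (¬_; yes; no)
open import Relation.Binary.PropositionalEquality using (_≡_)
open import Function.Definitions using (Injective)

record Graph : Set₁ where
  field
    n      : ℕ
    Adj    : Fin n → Fin n → Set
    sym    : ∀ {u v} → Adj u v → Adj v u
    irrefl : ∀ {v} → ¬ Adj v v

module _ (G : Graph) where
  open Graph G

  data IsWalk (E : Fin n → Fin n → Set) : Fin n → Fin n → List (Fin n) → Set where
    single : ∀ {a} → IsWalk E a a (a ∷ [])
    step   : ∀ {a x b xs} → E a x → IsWalk E x b xs → IsWalk E a b (a ∷ xs)

  record Path (E : Fin n → Fin n → Set) (a b : Fin n) : Set where
    field
      verts  : List (Fin n)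
      walk   : IsWalk E a b verts
      unique : Unique verts

  ConnectedMinus : List (Fin n) → Set
  ConnectedMinus X =
    (∃ λ v → v ∉ X) ×
    (∀ u v → u ∉ X → v ∉ X →
       Σ (Path Adj u v) λ P → All (λ w → w ∉ X) (Path.verts P))

  -- Diestel: G is k-connected if |G| > k and G - X is connected for all X with |X| < k.
  KConnected : ℕ → Set
  KConnected k = k < n × (∀ (X : List (Fin n)) → Unique X → length X < k → ConnectedMinus X)

next : ∀ {m} → Fin (suc m) → Fin (suc m)
next {m} i with m ℕ.≟ toℕ i
... | yes _ = zero
... | no ne = suc (lower₁ i ne)

module _ (G : Graph) where
  open Graph G

  -- A cycle C ⊆ G of length k = 3 + m, given by its vertices c 0, ..., c (k-1)
  -- in cyclic order (pairwise distinct, consecutive ones adjacent in G).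
  record Cycle : Set where
    field
      m     : ℕ
      vtx   : Fin (suc (suc (suc m))) → Fin n
      inj   : Injective _≡_ _≡_ vtx
      edges : ∀ i → Adj (vtx i) (vtx (next i))

  CycleEdge : Cycle → Fin n → Fin n → Set
  CycleEdge C u v = ∃ λ i → (u ≡ vtx i × v ≡ vtx (next i)) ⊎ (v ≡ vtx i × u ≡ vtx (next i))
    where open Cycle C

  AdjMinusC : Cycle → Fin n → Fin n → Set
  AdjMinusC C u v = Adj u v × ¬ CycleEdge C u v

  Interleaved : Cycle → Set
  Interleaved C =
    Σ (Fin k) λ i₁ → Σ (Fin k) λ i₂ → Σ (Fin k) λ i₃ → Σ (Fin k) λ i₄ →
      i₁ <ᶠ i₂ × i₂ <ᶠ i₃ × i₃ <ᶠ i₄ ×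
      Σ (Path G (AdjMinusC C) (vtx i₁) (vtx i₃)) λ P →
      Σ (Path G (AdjMinusC C) (vtx i₂) (vtx i₄)) λ Q →
        ∀ w → w ∈ Path.verts P → w ∈ Path.verts Q → ⊥
    where
      open Cycle C
      k = suc (suc (suc m))

  NonInterleaved : Cycle → Set
  NonInterleaved C = ¬ Interleaved C

  Induced : Cycle → Set
  Induced C = ∀ i j → Adj (vtx i) (vtx j) → CycleEdge C (vtx i) (vtx j)
    where open Cycle C

-- Suppose C has a chord c_i c_j with i < j. The other vertices of C fall into
-- two arcs, the inside (indices strictly between i and j) and the outside, both
-- non-empty because the chord is not an edge of C, and every edge of C missing
-- c_i and c_j stays within one arc. As G is 3-connected, G − {c_i, c_j} has a
-- walk from the inside to the outside; cutting it where it changes arcs gives a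
-- walk from an inner to an outer vertex that uses no edge of C. Shortened to a
-- path, it is disjoint from the chord, and their ends alternate along C.
module Submission where

open import Defs
open import Data.Nat as ℕ using (suc; z≤n; s≤s)
import Data.Nat.Properties as ℕ
open import Data.Fin using (Fin; zero; suc; toℕ; fromℕ; _<_; _≤_; _<?_)
open import Data.Fin.Properties
  using (any?; _≟_; toℕ<n; toℕ-fromℕ; toℕ-lower₁; ≤∧≢⇒<; <⇒≢; <-trans; <-asym; <-cmp)
open import Data.Product using (Σ; ∃; _×_; _,_; proj₁; proj₂)
open import Data.Sum using (_⊎_; inj₁; inj₂; [_,_])
open import Data.Empty using (⊥-elim)
open import Data.List using (List; []; _∷_; _∷ʳ_; reverse)
open import Data.List.Properties using (unfold-reverse)
open import Data.List.Membership.Propositional using (_∈_; _∉_)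
open import Data.List.Relation.Unary.Any using (here; there)
open import Data.List.Relation.Unary.Any.Properties using (reverse⁻)
open import Data.List.Relation.Unary.All using (All; []; _∷_; lookup)
open import Data.List.Relation.Unary.All.Properties using (¬Any⇒All¬)
open import Data.List.Relation.Unary.AllPairs using ([]; _∷_)
open import Data.List.Relation.Unary.Unique.Propositional using (Unique)
open import Data.List.Relation.Binary.Subset.Propositional using (_⊆_)
open import Data.List.Relation.Binary.Subset.Propositional.Properties
  using (All-resp-⊇; ⊆-refl; ⊆-trans; xs⊆x∷xs; ∷⁺ʳ)
open import Function using (_∘_)
open import Relation.Binary using (tri<; tri≈; tri>)
open import Relation.Binary.PropositionalEquality using (_≡_; _≢_; refl; sym; cong; subst)
open import Relation.Nullary using (¬_; Dec; yes; no; _×-dec_; _⊎-dec_)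
open import Relation.Unary using (Decidable)

next-cases : ∀ {m} (t : Fin (suc m)) →
             (toℕ t ≡ m × next t ≡ zero) ⊎ toℕ (next t) ≡ suc (toℕ t)
next-cases {m} t with m ℕ.≟ toℕ t
... | yes m≡t = inj₁ (sym m≡t , refl)
... | no m≢t  = inj₂ (cong suc (toℕ-lower₁ t m≢t))

module _ {m} {t u : Fin (suc m)} (t<u : t < u) where

  next-suc : toℕ (next t) ≡ suc (toℕ t)
  next-suc with next-cases t
  ... | inj₂ next≡suc    = next≡suc
  ... | inj₁ (t≡m , _) =
    ⊥-elim (ℕ.<-irrefl t≡m (ℕ.<-≤-trans t<u (ℕ.≤-pred (toℕ<n u))))

  <-next : t < next t
  <-next = subst (toℕ t ℕ.<_) (sym next-suc) (ℕ.n<1+n (toℕ t))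

  next-≤ : next t ≤ u
  next-≤ = subst (ℕ._≤ toℕ u) (sym next-suc) t<u

Inside Outside : ∀ {m} → Fin m → Fin m → Fin m → Set
Inside  i j t = i < t × t < j
Outside i j t = t < i ⊎ j < t

module _ {m} {i j : Fin (suc m)} where

  inside? : Decidable (Inside i j)
  inside? t = (i <? t) ×-dec (t <? j)

  outside? : Decidable (Outside i j)
  outside? t = (t <? i) ⊎-dec (j <? t)

  inside⇒¬outside : ∀ {t} → Inside i j t → ¬ Outside i j t
  inside⇒¬outside (i<t , _) (inj₁ t<i) = <-asym i<t t<i
  inside⇒¬outside (_ , t<j) (inj₂ j<t) = <-asym t<j j<t

  inside⇒≢ : ∀ {t} → Inside i j t → t ≢ i × t ≢ j
  inside⇒≢ (i<t , t<j) = (λ t≡i → <⇒≢ i<t (sym t≡i)) , <⇒≢ t<j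

  outside⇒≢ : i < j → ∀ {t} → Outside i j t → t ≢ i × t ≢ j
  outside⇒≢ i<j (inj₁ t<i) = <⇒≢ t<i , <⇒≢ (<-trans t<i i<j)
  outside⇒≢ i<j (inj₂ j<t) = (λ t≡i → <⇒≢ (<-trans i<j j<t) (sym t≡i)) , (λ t≡j → <⇒≢ j<t (sym t≡j))

  inside⊎outside : ∀ {t} → t ≢ i × t ≢ j → Inside i j t ⊎ Outside i j t
  inside⊎outside {t} (t≢i , t≢j) with <-cmp t i | <-cmp t j
  ... | tri< t<i _ _ | _            = inj₂ (inj₁ t<i)
  ... | tri≈ _ t≡i _ | _            = ⊥-elim (t≢i t≡i)
  ... | tri> _ _ i<t | tri< t<j _ _ = inj₁ (i<t , t<j)
  ... | tri> _ _ _   | tri≈ _ t≡j _ = ⊥-elim (t≢j t≡j)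
  ... | tri> _ _ _   | tri> _ _ j<t = inj₂ (inj₂ j<t)

  next-inside : i < j → next i ≢ j → Inside i j (next i)
  next-inside i<j next≢j = <-next i<j , ≤∧≢⇒< (next-≤ i<j) next≢j

  inside-next : ∀ {t} → Inside i j t → next t ≢ j → Inside i j (next t)
  inside-next (i<t , t<j) next≢j = <-trans i<t (<-next t<j) , ≤∧≢⇒< (next-≤ t<j) next≢j

  outside-next : ∀ {t} → Outside i j t → next t ≢ i → Outside i j (next t)
  outside-next (inj₁ t<i) next≢i = inj₁ (≤∧≢⇒< (next-≤ t<i) next≢i)
  outside-next {t} (inj₂ j<t) next≢i with next-cases t
  ... | inj₁ (_ , next≡0) = inj₁ (subst (_< i) (sym next≡0)
                                   (≤∧≢⇒< z≤n λ 0≡i → next≢i (subst (_≡ i) (sym next≡0) 0≡i)))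
  ... | inj₂ next≡suc      = inj₂ (subst (toℕ j ℕ.<_) (sym next≡suc) (ℕ.m<n⇒m<1+n j<t))

outside-nonempty : ∀ {m} {i j : Fin (suc m)} → i < j → next j ≢ i → ∃ (Outside i j)
outside-nonempty {i = suc _} _ _ = zero , inj₁ (s≤s z≤n)
outside-nonempty {m} {i = zero} {j} _ next≢0 with next-cases j
... | inj₁ (_ , next≡0) = ⊥-elim (next≢0 next≡0)
... | inj₂ next≡suc     = fromℕ m , inj₂ (subst (toℕ j ℕ.<_) (sym (toℕ-fromℕ m)) j<m)
  where
    j<m : toℕ j ℕ.< m
    j<m = ℕ.s<s⁻¹ (subst (ℕ._< suc m) next≡suc (toℕ<n (next j)))

module _ (G : Graph) where
  open Graph G using (n)
  open import Data.List.Membership.DecPropositional (_≟_ {n}) using (_∈?_)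

  private
    Rel : Set₁
    Rel = Fin n → Fin n → Set

  walk-head : ∀ {E a b xs} → IsWalk G E a b xs → a ∈ xs
  walk-head single     = here refl
  walk-head (step _ _) = here refl

  IsWalk-map : ∀ {E E′ : Rel} → (∀ {u v} → E u v → E′ u v) →
               ∀ {a b xs} → IsWalk G E a b xs → IsWalk G E′ a b xs
  IsWalk-map f single      = single
  IsWalk-map f (step e wk) = step (f e) (IsWalk-map f wk)

  Within : (Fin n → Set) → Rel → Rel
  Within P E u v = E u v × P u × P v

  IsWalk-within : ∀ {P E a b xs} → All P xs → IsWalk G E a b xs → IsWalk G (Within P E) a b xs
  IsWalk-within _          single      = single
  IsWalk-within (pa ∷ pxs) (step e wk) = step (e , pa , lookup pxs (walk-head wk)) (IsWalk-within pxs wk)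

  IsWalk-∷ʳ : ∀ {E a b c xs} → IsWalk G E a b xs → E b c → IsWalk G E a c (xs ∷ʳ c)
  IsWalk-∷ʳ single      e = step e single
  IsWalk-∷ʳ (step e wk) f = step e (IsWalk-∷ʳ wk f)

  IsWalk-reverse : ∀ {E : Rel} → (∀ {u v} → E u v → E v u) →
                   ∀ {a b xs} → IsWalk G E a b xs → IsWalk G E b a (reverse xs)
  IsWalk-reverse sym-E single = single
  IsWalk-reverse sym-E {a} (step {xs = xs} e wk) =
    subst (IsWalk G _ _ a) (sym (unfold-reverse a xs)) (IsWalk-∷ʳ (IsWalk-reverse sym-E wk) (sym-E e))

  suffix-path : ∀ {E a x b xs} → IsWalk G E x b xs → Unique xs → a ∈ xs →
                Σ (Path G E a b) λ P → Path.verts P ⊆ xs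
  suffix-path single        u (here refl) = record { verts = _ ; walk = single ; unique = u } , ⊆-refl
  suffix-path wk@(step _ _) u (here refl) = record { verts = _ ; walk = wk ; unique = u } , ⊆-refl
  suffix-path (step _ wk) (_ ∷ u) (there a∈xs) with suffix-path wk u a∈xs
  ... | P , P⊆xs = P , ⊆-trans P⊆xs (xs⊆x∷xs _ _)

  walk⇒path : ∀ {E a b xs} → IsWalk G E a b xs → Σ (Path G E a b) λ P → Path.verts P ⊆ xs
  walk⇒path single = record { verts = _ ; walk = single ; unique = [] ∷ [] } , ⊆-refl
  walk⇒path {a = a} (step {xs = xs} e wk) with walk⇒path wk
  ... | P , P⊆xs with a ∈? Path.verts P
  ...   | yes a∈P = let Q , Q⊆P = suffix-path (Path.walk P) (Path.unique P) a∈P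
                    in Q , ⊆-trans (⊆-trans Q⊆P P⊆xs) (xs⊆x∷xs _ _)
  ...   | no a∉P  = record { verts = a ∷ Path.verts P ; walk = step e (Path.walk P)
                           ; unique = ¬Any⇒All¬ _ a∉P ∷ Path.unique P } ,
                    ∷⁺ʳ a P⊆xs

  Crossing : (A B : Fin n → Set) → Rel → Rel
  Crossing A B E u v = E u v × ¬ (A u × A v) × ¬ (B u × B v)

  module _ {E : Rel} {A B : Fin n → Set} (A? : Decidable A) (B? : Decidable B)
           (A⇒¬B : ∀ {w} → A w → ¬ B w) where

    record CrossingWalk (S : Fin n → Set) (xs : List (Fin n)) : Set where
      constructor crossingWalk
      field
        {start end} : Fin n
        {verts}     : List (Fin n)
        start∈S     : S start
        end∈B       : B end
        walk        : IsWalk G (Crossing A B E) start end verts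
        verts⊆xs    : verts ⊆ xs

    crossing-walk-from : ∀ {w b xs} → IsWalk G E w b xs → B b → ¬ B w →
                         CrossingWalk (λ a → a ≡ w ⊎ A a) xs
    crossing-walk-from single b∈B w∉B = ⊥-elim (w∉B b∈B)
    crossing-walk-from (step {x = x} e wk) b∈B w∉B with B? x
    ... | yes x∈B = crossingWalk (inj₁ refl) x∈B
                      (step (e , (λ (_ , x∈A) → A⇒¬B x∈A x∈B) , (λ (w∈B , _) → w∉B w∈B)) single)
                      (∷⁺ʳ _ λ { (here refl) → walk-head wk })
    ... | no x∉B with crossing-walk-from wk b∈B x∉B
    ...   | crossingWalk (inj₂ a∈A) c∈B cw cw⊆xs = crossingWalk (inj₂ a∈A) c∈B cw (⊆-trans cw⊆xs (xs⊆x∷xs _ _))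
    ...   | crossingWalk (inj₁ refl) c∈B cw cw⊆xs with A? x
    ...     | yes x∈A = crossingWalk (inj₂ x∈A) c∈B cw (⊆-trans cw⊆xs (xs⊆x∷xs _ _))
    ...     | no x∉A  = crossingWalk (inj₁ refl) c∈B
                          (step (e , (λ (_ , x∈A) → x∉A x∈A) , (λ (_ , x∈B) → x∉B x∈B)) cw)
                          (∷⁺ʳ _ cw⊆xs)

    crossing-walk : ∀ {a b xs} → IsWalk G E a b xs → A a → B b → CrossingWalk A xs
    crossing-walk wk a∈A b∈B with crossing-walk-from wk b∈B (A⇒¬B a∈A)
    ... | crossingWalk (inj₁ refl) c∈B cw cw⊆xs = crossingWalk a∈A c∈B cw cw⊆xs
    ... | crossingWalk (inj₂ s∈A)  c∈B cw cw⊆xs = crossingWalk s∈A c∈B cw cw⊆xs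

module _ (G : Graph) (C : Cycle G) where
  open Graph G renaming (sym to Adj-sym)
  open Cycle C

  Index : Set
  Index = Fin (suc (suc (suc m)))

  CycleEdge-sym : ∀ {u v} → CycleEdge G C u v → CycleEdge G C v u
  CycleEdge-sym (t , inj₁ u,v) = t , inj₂ u,v
  CycleEdge-sym (t , inj₂ v,u) = t , inj₁ v,u

  CycleEdge? : ∀ u v → Dec (CycleEdge G C u v)
  CycleEdge? u v = any? λ t → ((u ≟ vtx t) ×-dec (v ≟ vtx (next t)))
                         ⊎-dec ((v ≟ vtx t) ×-dec (u ≟ vtx (next t)))

  AdjMinusC-sym : ∀ {u v} → AdjMinusC G C u v → AdjMinusC G C v u
  AdjMinusC-sym (adj , ¬ce) = Adj-sym adj , ¬ce ∘ CycleEdge-sym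

  On : (Index → Set) → Fin n → Set
  On S w = ∃ λ t → w ≡ vtx t × S t

  On? : ∀ {S} → Decidable S → Decidable (On S)
  On? S? w = any? λ t → (w ≟ vtx t) ×-dec S? t

  On-disjoint : ∀ {S T} → (∀ {t} → S t → ¬ T t) → ∀ {w} → On S w → ¬ On T w
  On-disjoint S⇒¬T (s , refl , s∈S) (t , vs≡vt , t∈T) rewrite inj vs≡vt = S⇒¬T s∈S t∈T

  module _ {i j : Index} (i<j : i < j) where

    ends : List (Fin n)
    ends = vtx i ∷ vtx j ∷ []

    ends-unique : Unique ends
    ends-unique = ((<⇒≢ i<j ∘ inj) ∷ []) ∷ [] ∷ []

    ≢⇒∉ends : ∀ {t} → t ≢ i × t ≢ j → vtx t ∉ ends
    ≢⇒∉ends (t≢i , _) (here vt≡vi)         = t≢i (inj vt≡vi)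
    ≢⇒∉ends (_ , t≢j) (there (here vt≡vj)) = t≢j (inj vt≡vj)

    ∉ends⇒≢ : ∀ {t} → vtx t ∉ ends → t ≢ i × t ≢ j
    ∉ends⇒≢ vt∉ends = (λ t≡i → vt∉ends (here (cong vtx t≡i)))
                    , (λ t≡j → vt∉ends (there (here (cong vtx t≡j))))

    arc-step : ∀ t → vtx t ∉ ends → vtx (next t) ∉ ends →
               (Inside i j t × Inside i j (next t)) ⊎ (Outside i j t × Outside i j (next t))
    arc-step t t∉ends next∉ends with inside⊎outside (∉ends⇒≢ t∉ends)
    ... | inj₁ t∈in  = inj₁ (t∈in , inside-next t∈in (proj₂ (∉ends⇒≢ next∉ends)))
    ... | inj₂ t∈out = inj₂ (t∈out , outside-next t∈out (proj₁ (∉ends⇒≢ next∉ends)))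

    OnInside OnOutside : Fin n → Set
    OnInside  = On (Inside i j)
    OnOutside = On (Outside i j)

    cycleEdge-within-arc : ∀ {u v} → CycleEdge G C u v → u ∉ ends → v ∉ ends →
                           (OnInside u × OnInside v) ⊎ (OnOutside u × OnOutside v)
    cycleEdge-within-arc (t , inj₁ (refl , refl)) u∉ends v∉ends with arc-step t u∉ends v∉ends
    ... | inj₁ (t∈in  , next∈in)  = inj₁ ((t , refl , t∈in)  , (next t , refl , next∈in))
    ... | inj₂ (t∈out , next∈out) = inj₂ ((t , refl , t∈out) , (next t , refl , next∈out))
    cycleEdge-within-arc (t , inj₂ (refl , refl)) u∉ends v∉ends with arc-step t v∉ends u∉ends
    ... | inj₁ (t∈in  , next∈in)  = inj₁ ((next t , refl , next∈in)  , (t , refl , t∈in))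
    ... | inj₂ (t∈out , next∈out) = inj₂ ((next t , refl , next∈out) , (t , refl , t∈out))

    crossing⇒AdjMinusC : ∀ {u v} → Crossing G OnInside OnOutside (Within G (_∉ ends) Adj) u v →
                         AdjMinusC G C u v
    crossing⇒AdjMinusC ((adj , u∉ends , v∉ends) , ¬both-in , ¬both-out) =
      adj , λ ce → [ ¬both-in , ¬both-out ] (cycleEdge-within-arc ce u∉ends v∉ends)

    module _ (adj : Adj (vtx i) (vtx j)) (¬ce : ¬ CycleEdge G C (vtx i) (vtx j)) where

      chord : Path G (AdjMinusC G C) (vtx i) (vtx j)
      chord = record { verts = ends ; walk = step (adj , ¬ce) single ; unique = ends-unique }

      interleaved-by-chord : ∀ {a b zs} → OnInside a → OnOutside b → IsWalk G (AdjMinusC G C) a b zs →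
                             All (_∉ ends) zs → Interleaved G C
      interleaved-by-chord (s , refl , i<s , s<j) (t , refl , inj₂ j<t) wk zs∉ends =
        let Q , Q⊆zs = walk⇒path G wk
        in i , s , j , t , i<s , s<j , j<t , chord , Q ,
           λ { w w∈chord w∈Q → lookup zs∉ends (Q⊆zs w∈Q) w∈chord }
      interleaved-by-chord (s , refl , i<s , s<j) (t , refl , inj₁ t<i) wk zs∉ends =
        let Q , Q⊆rev = walk⇒path G (IsWalk-reverse G AdjMinusC-sym wk)
        in t , i , s , j , t<i , i<s , s<j , Q , chord ,
           λ { w w∈Q w∈chord → lookup zs∉ends (reverse⁻ (Q⊆rev w∈Q)) w∈chord }

      chord⇒interleaved : KConnected G 3 → Interleaved G C
      chord⇒interleaved (_ , connected) =
        let b , b∈out   = outside-nonempty i<j λ next≡i → ¬ce (j , inj₂ (refl , cong vtx (sym next≡i)))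
            P , P∉ends  = proj₂ (connected ends ends-unique (s≤s (s≤s (s≤s z≤n))))
                            (vtx (next i)) (vtx b)
                            (≢⇒∉ends (inside⇒≢ next-i∈in)) (≢⇒∉ends (outside⇒≢ i<j b∈out))
            crossingWalk a∈in c∈out cw cw⊆P =
              crossing-walk G (On? inside?) (On? outside?) (On-disjoint inside⇒¬outside)
                (IsWalk-within G P∉ends (Path.walk P)) (next i , refl , next-i∈in) (b , refl , b∈out)
        in interleaved-by-chord a∈in c∈out (IsWalk-map G crossing⇒AdjMinusC cw) (All-resp-⊇ cw⊆P P∉ends)
        where
          next-i∈in : Inside i j (next i)
          next-i∈in = next-inside i<j λ next≡j → ¬ce (i , inj₁ (refl , cong vtx (sym next≡j)))

lemma6p3 : (G : Graph) → KConnected G 3 → (C : Cycle G) → NonInterleaved G C → Induced G C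
lemma6p3 G 3-connected C non-interleaved i j adj
  with CycleEdge? G C (Cycle.vtx C i) (Cycle.vtx C j) | <-cmp i j
... | yes ce | _             = ce
... | no _   | tri≈ _ refl _ = ⊥-elim (Graph.irrefl G adj)
... | no ¬ce | tri< i<j _ _  =
  ⊥-elim (non-interleaved (chord⇒interleaved G C i<j adj ¬ce 3-connected))
... | no ¬ce | tri> _ _ j<i  =
  ⊥-elim (non-interleaved (chord⇒interleaved G C j<i (Graph.sym G adj) (¬ce ∘ CycleEdge-sym G C) 3-connected))
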